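{- If $T$ is a tree of order $n\ge 4$, then $C_{tr}(T)\le n-2$.
   Context: A set $S\subseteq V$ is a total restrained dominating set (TRD-set) of $G=(V,E)$ if every vertex of $V\setminus S$ is adjacent to at least one vertex of $S$ and to at least one other vertex of $V\setminus S$, and every vertex of $S$ is adjacent to at least one other vertex of $S$. Two disjoint sets $X,Y\subseteq V$ form a total restrained coalition if neither is a TRD-set but $X\cup Y$ is a TRD-set. A trc-partition of $G$ is a partition $\Phi$ of $V$ such that no member of $\Phi$ is a TRD-set and each member forms a total restrained coalition with some other member of $\Phi$. $C_{tr}(G)$ is the maximum cardinality of a trc-partition of $G$. -}

module Defs where

open import Data.Nat using (ℕ; zero; suc; _≤_)
open import Data.Fin using (Fin; zero; suc; inject₁; fromℕ; _≟_)
open import Data.Bool using (Bool; true; false; _∨_)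
open import Data.Product using (Σ; ∃; _×_; _,_)
open import Relation.Nullary using (¬_; does)
open import Relation.Binary.PropositionalEquality using (_≡_; _≢_)
open import Function.Definitions using (Injective; Surjective)

record Graph (n : ℕ) : Set where
  field
    adj  : Fin n → Fin n → Bool
    sym  : ∀ u v → adj u v ≡ adj v u
    irr  : ∀ v → adj v v ≡ false

module _ {n : ℕ} (G : Graph n) where
  open Graph G

  Adj : Fin n → Fin n → Set
  Adj u v = adj u v ≡ true

  data Walk : Fin n → Fin n → Set where
    here : ∀ {v} → Walk v v
    step : ∀ {u w v} → Adj u w → Walk w v → Walk u v

  Connected : Set
  Connected = ∀ u v → Walk u v

  -- a cycle of length m + 1 ≥ 3: distinct vertices c 0, …, c m with
  -- consecutive ones adjacent and c m adjacent to c 0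
  IsCycle : (m : ℕ) → (Fin (suc m) → Fin n) → Set
  IsCycle m c =
    2 ≤ m × Injective _≡_ _≡_ c
          × (∀ (i : Fin m) → Adj (c (inject₁ i)) (c (suc i)))
          × Adj (c (fromℕ m)) (c zero)

  Acyclic : Set
  Acyclic = ∀ m c → ¬ IsCycle m c

  IsTree : Set
  IsTree = Connected × Acyclic

  Subset : Set
  Subset = Fin n → Bool

  IsTRD : Subset → Set
  IsTRD S =
    (∀ v → S v ≡ false →
        (∃ λ u → S u ≡ true × Adj v u)
      × (∃ λ w → S w ≡ false × w ≢ v × Adj v w))
    × (∀ v → S v ≡ true → ∃ λ u → S u ≡ true × u ≢ v × Adj v u)

  -- a partition of V into k (nonempty) members, given by the map p sending
  -- each vertex to the index of its member; surjectivity = members nonempty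
  member : {k : ℕ} → (Fin n → Fin k) → Fin k → Subset
  member p i v = does (p v ≟ i)

  IsTrcPartition : (k : ℕ) → (Fin n → Fin k) → Set
  IsTrcPartition k p =
    Surjective _≡_ _≡_ p
    × (∀ i → ¬ IsTRD (member p i))
    × (∀ i → ∃ λ j → j ≢ i × IsTRD (λ v → member p i v ∨ member p j v))

-- In a tree, a total restrained dominating set S that misses some vertex r
-- has at least four vertices: r has a neighbour r' outside S, r and r' have
-- neighbours a and b in S, and a and b have neighbours c and d in S; the
-- absence of cycles of length 3, 4 and 5 forces a, b, c, d to be distinct.
-- In a trc-partition with at least three members, the union of two
-- coalition partners is such a set (a third member lies outside it), so
-- these four vertices together with one vertex from each of the remaining
-- k − 2 members give k + 2 distinct vertices.
module Submission where

open import Defs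
open import Data.Nat using (ℕ; zero; suc; _+_; _≤_; _∸_; z≤n; s≤s)
open import Data.Nat.Properties using (≤-trans; ≤-reflexive; +-comm; m+n≤o⇒m≤o∸n)
open import Data.Fin using (Fin; zero; suc; inject₁; fromℕ; punchIn; punchOut; _≟_)
open import Data.Fin.Properties
  using (injective⇒≤; +↔⊎; punchIn-injective; punchInᵢ≢i; punchIn-punchOut)
open import Data.Vec using (Vec; []; _∷_; lookup)
open import Data.Vec.Relation.Unary.All as All using (All; []; _∷_)
open import Data.Vec.Relation.Unary.All.Properties using (lookup⁺)
open import Data.Vec.Relation.Unary.Linked using (Linked; [-]; _∷_)
open import Data.Vec.Relation.Unary.Unique.Propositional using (Unique)
open import Data.Vec.Relation.Unary.Unique.Propositional.Properties using (lookup-injective)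
open import Data.Vec.Relation.Unary.AllPairs using ([]; _∷_)
open import Data.Bool using (true; false; _∨_)
open import Data.Product using (Σ; _×_; _,_; proj₁; proj₂)
open import Data.Sum using (_⊎_; inj₁; inj₂; [_,_]′)
open import Data.Empty using (⊥-elim)
open import Function using (_∘_; Injection)
open import Function.Definitions using (Injective; Surjective)
open import Function.Properties.Inverse using (↔⇒↣)
open import Relation.Binary using (Rel)
open import Relation.Nullary using (¬_; yes; no)
open import Relation.Binary.PropositionalEquality using (_≡_; _≢_; refl; sym; trans; cong)

linked⇒lookup-suc : ∀ {a ℓ} {A : Set a} {R : Rel A ℓ} {m} {xs : Vec A (suc m)} →
  Linked R xs → (i : Fin m) → R (lookup xs (inject₁ i)) (lookup xs (suc i))
linked⇒lookup-suc {xs = _ ∷ _ ∷ _} (r ∷ _) zero = r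
linked⇒lookup-suc (_ ∷ rs) (suc i) = linked⇒lookup-suc rs i

[,]-injective : ∀ {a b c} {A : Set a} {B : Set b} {C : Set c} {f : A → C} {g : B → C} →
  Injective _≡_ _≡_ f → Injective _≡_ _≡_ g → (∀ x y → f x ≢ g y) →
  Injective _≡_ _≡_ [ f , g ]′
[,]-injective f-inj g-inj f≢g {inj₁ x} {inj₁ x′} e = cong inj₁ (f-inj e)
[,]-injective f-inj g-inj f≢g {inj₁ x} {inj₂ y′} e = ⊥-elim (f≢g x y′ e)
[,]-injective f-inj g-inj f≢g {inj₂ y} {inj₁ x′} e = ⊥-elim (f≢g x′ y (sym e))
[,]-injective f-inj g-inj f≢g {inj₂ y} {inj₂ y′} e = cong inj₂ (g-inj e)

disjoint-injections⇒+≤ : ∀ {m k n} {f : Fin m → Fin n} {g : Fin k → Fin n} →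
  Injective _≡_ _≡_ f → Injective _≡_ _≡_ g → (∀ x y → f x ≢ g y) → m + k ≤ n
disjoint-injections⇒+≤ {m} {k} f-inj g-inj f≢g =
  injective⇒≤ (Injection.injective (↔⇒↣ (+↔⊎ {m} {k})) ∘ [,]-injective f-inj g-inj f≢g)

avoiding-two : ∀ {k} {i j : Fin (suc (suc k))} → i ≢ j →
  Σ (Fin k → Fin (suc (suc k))) λ e → Injective _≡_ _≡_ e × (∀ t → e t ≢ i × e t ≢ j)
avoiding-two {k} {i} {j} i≢j = e , e-inj , λ t → punchInᵢ≢i i _ , e≢j t
  where
  j′ : Fin (suc k)
  j′ = punchOut i≢j
  e : Fin k → Fin (suc (suc k))
  e t = punchIn i (punchIn j′ t)
  e-inj : Injective _≡_ _≡_ e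
  e-inj {t} {u} = punchIn-injective j′ t u ∘ punchIn-injective i _ _
  e≢j : ∀ t → e t ≢ j
  e≢j t e≡j =
    punchInᵢ≢i j′ t (punchIn-injective i _ _ (trans e≡j (sym (punchIn-punchOut i≢j))))

module Sections {n k : ℕ} {p : Fin n → Fin k} (surjective : Surjective _≡_ _≡_ p) where

  section : Fin k → Fin n
  section t = proj₁ (surjective t)

  p∘section : ∀ t → p (section t) ≡ t
  p∘section t = proj₂ (surjective t) refl

  section-injective : Injective _≡_ _≡_ section
  section-injective {t} {u} eq = trans (sym (p∘section t)) (trans (cong p eq) (p∘section u))

m-in-two-fibres⇒m+k≤n : ∀ {n k} {p : Fin n → Fin (suc (suc k))} → Surjective _≡_ _≡_ p →
  ∀ {i j} → i ≢ j → ∀ {m} {ws : Vec (Fin n) m} →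
  Unique ws → All (λ v → p v ≡ i ⊎ p v ≡ j) ws → m + k ≤ n
m-in-two-fibres⇒m+k≤n {p = p} surjective i≢j {ws = ws} unique ws⊆i∪j
  with avoiding-two i≢j
... | e , e-injective , e-avoids =
  disjoint-injections⇒+≤
    (lookup-injective unique _ _) (e-injective ∘ section-injective) ws≢section∘e
  where
  open Sections surjective
  e≡p∘section∘e : ∀ t → e t ≡ p (section (e t))
  e≡p∘section∘e t = sym (p∘section (e t))
  ws≢section∘e : ∀ x t → lookup ws x ≢ section (e t)
  ws≢section∘e x t eq with lookup⁺ ws⊆i∪j x | e-avoids t
  ... | inj₁ p≡i | e≢i , _ = e≢i (trans (e≡p∘section∘e t) (trans (cong p (sym eq)) p≡i))
  ... | inj₂ p≡j | _ , e≢j = e≢j (trans (e≡p∘section∘e t) (trans (cong p (sym eq)) p≡j))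

module _ {n : ℕ} (G : Graph n) where

  Adj-sym : ∀ {u v} → Adj G u v → Adj G v u
  Adj-sym {u} {v} = trans (Graph.sym G v u)

  acyclic⇒¬closed-path : Acyclic G → ∀ {m} (xs : Vec (Fin n) (suc (suc (suc m)))) →
    Unique xs → Linked (Adj G) xs → ¬ Adj G (lookup xs (fromℕ (suc (suc m)))) (lookup xs zero)
  acyclic⇒¬closed-path acyclic xs distinct path closing =
    acyclic _ (lookup xs)
      (s≤s (s≤s z≤n) , lookup-injective distinct _ _ , linked⇒lookup-suc path , closing)

  module _ (S : Subset G) where

    ∉S∧∈S⇒≢ : ∀ {u v} → S u ≡ false → S v ≡ true → u ≢ v
    ∉S∧∈S⇒≢ u∉S u∈S refl with trans (sym u∈S) u∉S
    ... | ()

    acyclic∧TRD⇒four-members : Acyclic G → IsTRD G S → ∀ r → S r ≡ false →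
      Σ (Vec (Fin n) 4) λ ws → Unique ws × All (λ v → S v ≡ true) ws
    acyclic∧TRD⇒four-members acyclic (dominated , total) r r∉S
      with dominated r r∉S
    ... | (a , a∈S , r~a) , (r′ , r′∉S , r′≢r , r~r′)
      with proj₁ (dominated r′ r′∉S)
    ... | b , b∈S , r′~b
      with total a a∈S | total b b∈S
    ... | c , c∈S , c≢a , a~c | d , d∈S , d≢b , b~d =
      a ∷ b ∷ c ∷ d ∷ [] ,
      (a≢b ∷ (c≢a ∘ sym) ∷ (d≢a ∘ sym) ∷ [])
        ∷ (b≢c ∷ (d≢b ∘ sym) ∷ []) ∷ (c≢d ∷ []) ∷ [] ∷ [] ,
      a∈S ∷ b∈S ∷ c∈S ∷ d∈S ∷ []
      where
      r≢r′ : r ≢ r′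
      r≢r′ = r′≢r ∘ sym
      r≢ : ∀ {v} → S v ≡ true → r ≢ v
      r≢ = ∉S∧∈S⇒≢ r∉S
      r′≢ : ∀ {v} → S v ≡ true → r′ ≢ v
      r′≢ = ∉S∧∈S⇒≢ r′∉S
      a≢b : a ≢ b
      a≢b refl = acyclic⇒¬closed-path acyclic (r ∷ r′ ∷ a ∷ [])
        ((r≢r′ ∷ r≢ a∈S ∷ []) ∷ (r′≢ a∈S ∷ []) ∷ [] ∷ [])
        (r~r′ ∷ r′~b ∷ [-]) (Adj-sym r~a)
      b≁a : ¬ Adj G b a
      b≁a b~a = acyclic⇒¬closed-path acyclic (r ∷ r′ ∷ b ∷ a ∷ [])
        ((r≢r′ ∷ r≢ b∈S ∷ r≢ a∈S ∷ [])
          ∷ (r′≢ b∈S ∷ r′≢ a∈S ∷ []) ∷ ((a≢b ∘ sym) ∷ []) ∷ [] ∷ [])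
        (r~r′ ∷ r′~b ∷ b~a ∷ [-]) (Adj-sym r~a)
      b≢c : b ≢ c
      b≢c refl = b≁a (Adj-sym a~c)
      d≢a : d ≢ a
      d≢a refl = b≁a b~d
      c≢d : c ≢ d
      c≢d refl = acyclic⇒¬closed-path acyclic (r ∷ r′ ∷ b ∷ c ∷ a ∷ [])
        ((r≢r′ ∷ r≢ b∈S ∷ r≢ c∈S ∷ r≢ a∈S ∷ [])
          ∷ (r′≢ b∈S ∷ r′≢ c∈S ∷ r′≢ a∈S ∷ [])
          ∷ (b≢c ∷ (a≢b ∘ sym) ∷ []) ∷ (c≢a ∷ []) ∷ [] ∷ [])
        (r~r′ ∷ r′~b ∷ b~d ∷ Adj-sym a~c ∷ [-]) (Adj-sym r~a)

  module _ {k : ℕ} (p : Fin n → Fin k) where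

    ∈member⇒ : ∀ {i v} → member G p i v ≡ true → p v ≡ i
    ∈member⇒ {i} {v} v∈i with p v ≟ i
    ... | yes pv≡i = pv≡i

    ∉member : ∀ {i v} → p v ≢ i → member G p i v ≡ false
    ∉member {i} {v} pv≢i with p v ≟ i
    ... | yes pv≡i = ⊥-elim (pv≢i pv≡i)
    ... | no _     = refl

    ∈union⇒ : ∀ {i j v} → (member G p i v ∨ member G p j v) ≡ true → p v ≡ i ⊎ p v ≡ j
    ∈union⇒ {i} {j} {v} v∈i∪j with member G p i v in v∈i
    ... | true  = inj₁ (∈member⇒ v∈i)
    ... | false = inj₂ (∈member⇒ v∈i∪j)

    ∉union : ∀ {i j v} → p v ≢ i → p v ≢ j → (member G p i v ∨ member G p j v) ≡ false
    ∉union pv≢i pv≢j rewrite ∉member pv≢i | ∉member pv≢j = refl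

  acyclic-trc-partition⇒members+2≤order : Acyclic G →
    ∀ {k} (p : Fin n → Fin (suc (suc (suc k)))) → IsTrcPartition G _ p → 2 + (3 + k) ≤ n
  acyclic-trc-partition⇒members+2≤order acyclic {k} p (surjective , _ , coalition)
    with coalition zero
  ... | j , j≢0 , S-TRD with avoiding-two (j≢0 ∘ sym)
  ... | e , _ , e-avoids =
    four⇒bound (acyclic∧TRD⇒four-members S acyclic S-TRD
                  (section (e zero)) (section-∉S (e-avoids zero)))
    where
    open Sections surjective
    S : Subset G
    S v = member G p zero v ∨ member G p j v
    section-∉S : ∀ {t} → t ≢ zero × t ≢ j → S (section t) ≡ false
    section-∉S {t} (t≢0 , t≢j) =
      ∉union p (t≢0 ∘ trans (sym (p∘section t))) (t≢j ∘ trans (sym (p∘section t)))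
    four⇒bound : Σ (Vec (Fin n) 4) (λ ws → Unique ws × All (λ v → S v ≡ true) ws) →
      4 + (1 + k) ≤ n
    four⇒bound (_ , unique , ws⊆S) =
      m-in-two-fibres⇒m+k≤n surjective (j≢0 ∘ sym) unique (All.map (∈union⇒ p) ws⊆S)

corollary4p5 : (n : ℕ) → 4 ≤ n → (T : Graph n) → IsTree T →
    (k : ℕ) (p : Fin n → Fin k) → IsTrcPartition T k p → k ≤ n ∸ 2
corollary4p5 n 4≤n T (_ , acyclic) k p trc = m+n≤o⇒m≤o∸n k (members+2≤order k p trc)
  where
  members+2≤order : ∀ k (p : Fin n → Fin k) → IsTrcPartition T k p → k + 2 ≤ n
  members+2≤order 0 _ _ = ≤-trans (s≤s (s≤s z≤n)) 4≤n
  members+2≤order 1 _ _ = ≤-trans (s≤s (s≤s (s≤s z≤n))) 4≤n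
  members+2≤order 2 _ _ = 4≤n
  members+2≤order (suc (suc (suc k))) p trc =
    ≤-trans (≤-reflexive (+-comm (3 + k) 2))
            (acyclic-trc-partition⇒members+2≤order T acyclic p trc)
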